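{- Let $M=(m_i)_{i=0}^{\infty}$ be a sequence of integers with $m_0=1$ and $m_i\ge 2$ for $i\ge 1$, $M_i=\prod_{j=0}^{i}m_j$. Let $k\in\mathbb{N}$. Then for every integer $n\ge\frac{km_1}{m_1-1}$, \[ a_M(n-k,n)=s_M(k). \]
   Context: $a_M(j,n)$ denotes the number of representations of $n$ as a sum of exactly $j$ numbers from $\{M_0,M_1,\ldots\}$ (order irrelevant, repetitions allowed). $s_M(n)$ denotes the number of partitions of $n$ into parts from $\{M_i-1: i\ge1\}$, i.e. $\prod_{i=1}^{\infty}\frac{1}{1-x^{M_i-1}}=\sum_{n\ge0}s_M(n)x^n$. -}

module Defs where

open import Data.Nat using (ℕ; zero; suc; _+_; _*_; _∸_; _≤_; _≤?_)
open import Data.List using (List; []; _∷_; map; upTo; applyUpTo)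
open import Relation.Nullary.Decidable using (⌊_⌋)
open import Data.Bool using (if_then_else_)

prodM : (ℕ → ℕ) → ℕ → ℕ
prodM m zero    = m zero
prodM m (suc i) = prodM m i * m (suc i)

sumTo : ℕ → (ℕ → ℕ) → ℕ
sumTo zero    f = f zero
sumTo (suc b) f = sumTo b f + f (suc b)

-- repsExact ps j n : number of multiplicity assignments (c_p)_{p ∈ positions of ps}
-- with Σ c_p = j and Σ c_p * p = n  (i.e. multisets of exactly j parts drawn from
-- the list positions, summing to n).
repsExact : List ℕ → ℕ → ℕ → ℕ
repsExact []       zero    zero    = 1
repsExact []       _       _       = 0
repsExact (p ∷ ps) j n =
  sumTo j (λ c → if ⌊ c * p ≤? n ⌋ then repsExact ps (j ∸ c) (n ∸ c * p) else 0)

-- partsCount ps n : number of multiplicity assignments with Σ c_p * p = n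
-- (partitions of n into parts from the list; parts assumed ≥ 1, so c ≤ n).
partsCount : List ℕ → ℕ → ℕ
partsCount []       zero    = 1
partsCount []       (suc _) = 0
partsCount (p ∷ ps) n =
  sumTo n (λ c → if ⌊ c * p ≤? n ⌋ then partsCount ps (n ∸ c * p) else 0)

-- a_M(j,n): representations of n as a sum of exactly j numbers from {M_0, M_1, ...}.
-- Only M_0,...,M_n can occur, since M_i ≥ 2^i > n for i > n (when m_i ≥ 2 for i ≥ 1).
aM : (ℕ → ℕ) → ℕ → ℕ → ℕ
aM m j n = repsExact (applyUpTo (prodM m) (suc n)) j n

-- s_M(k): partitions of k into parts from {M_i - 1 : i ≥ 1}.
-- Only i = 1..k can occur, since M_i - 1 ≥ 2^i - 1 > k for i > k.
sM : (ℕ → ℕ) → ℕ → ℕ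
sM m k = partsCount (applyUpTo (λ i → prodM m (suc i) ∸ 1) k) k

module Submission where

-- Removing 1 from each of the j = n ∸ k parts turns a representation of n by parts
-- M₀ = 1, M₁, M₂, … into a representation of k by exactly j parts from 0, M₁ − 1, M₂ − 1, …,
-- i.e. a partition of k into at most j parts of the form Mᵢ − 1.  Every such part is at
-- least m₁ − 1, so a partition of k has at most k / (m₁ − 1) ≤ j parts, and the bound on
-- the number of parts is vacuous.  Since parts Mᵢ − 1 > k cannot occur, the lists of
-- candidate parts used by aM and sM may be cut to the same length.

open import Data.Bool using (if_then_else_)
open import Data.List using ([]; _∷_; _++_; map; applyUpTo)
open import Data.List.Properties using (map-applyUpTo)
open import Data.List.Relation.Unary.All as All using (All; []; _∷_)
open import Data.List.Relation.Unary.All.Properties using (map⁺; applyUpTo⁺₂)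
open import Data.Nat
open import Data.Nat.Properties
open import Data.Sum using (inj₁; inj₂)
open import Defs
open import Function using (_∘_)
open import Relation.Binary.PropositionalEquality
open import Relation.Nullary using (yes; no; ¬_; contradiction)
open import Relation.Nullary.Decidable using (⌊_⌋)

open import Algebra.Properties.CommutativeSemigroup +-commutativeSemigroup using (x∙yz≈y∙xz)

sumTo-cong : ∀ b {f g : ℕ → ℕ} → (∀ {c} → c ≤ b → f c ≡ g c) → sumTo b f ≡ sumTo b g
sumTo-cong zero    f≗g = f≗g z≤n
sumTo-cong (suc b) f≗g = cong₂ _+_ (sumTo-cong b (f≗g ∘ m≤n⇒m≤1+n)) (f≗g ≤-refl)

sumTo-zero : ∀ b {f : ℕ → ℕ} → (∀ {c} → c ≤ b → f c ≡ 0) → sumTo b f ≡ 0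
sumTo-zero zero    f≗0 = f≗0 z≤n
sumTo-zero (suc b) f≗0 = cong₂ _+_ (sumTo-zero b (f≗0 ∘ m≤n⇒m≤1+n)) (f≗0 ≤-refl)

sumTo-distrib : ∀ b (f g : ℕ → ℕ) → sumTo b (λ c → f c + g c) ≡ sumTo b f + sumTo b g
sumTo-distrib zero    f g = refl
sumTo-distrib (suc b) f g = begin
  sumTo b (λ c → f c + g c) + (f (suc b) + g (suc b))
    ≡⟨ cong (_+ (f (suc b) + g (suc b))) (sumTo-distrib b f g) ⟩
  (sumTo b f + sumTo b g) + (f (suc b) + g (suc b))
    ≡⟨ +-assoc (sumTo b f) (sumTo b g) _ ⟩
  sumTo b f + (sumTo b g + (f (suc b) + g (suc b)))
    ≡⟨ cong (sumTo b f +_) (x∙yz≈y∙xz (sumTo b g) (f (suc b)) (g (suc b))) ⟩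
  sumTo b f + (f (suc b) + (sumTo b g + g (suc b)))
    ≡⟨ +-assoc (sumTo b f) (f (suc b)) _ ⟨
  sumTo (suc b) f + sumTo (suc b) g ∎
  where open ≡-Reasoning

sumTo-peel : ∀ b (f : ℕ → ℕ) → sumTo (suc b) f ≡ f 0 + sumTo b (f ∘ suc)
sumTo-peel zero    f = refl
sumTo-peel (suc b) f = begin
  sumTo (suc b) f + f (suc (suc b))
    ≡⟨ cong (_+ f (suc (suc b))) (sumTo-peel b f) ⟩
  (f 0 + sumTo b (f ∘ suc)) + f (suc (suc b))
    ≡⟨ +-assoc (f 0) _ _ ⟩
  f 0 + sumTo (suc b) (f ∘ suc) ∎
  where open ≡-Reasoning

sumTo-reverse : ∀ b (f : ℕ → ℕ) → sumTo b (λ c → f (b ∸ c)) ≡ sumTo b f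
sumTo-reverse zero    f = refl
sumTo-reverse (suc b) f = begin
  sumTo (suc b) (λ c → f (suc b ∸ c))   ≡⟨ sumTo-peel b _ ⟩
  f (suc b) + sumTo b (λ c → f (b ∸ c)) ≡⟨ cong (f (suc b) +_) (sumTo-reverse b f) ⟩
  f (suc b) + sumTo b f                 ≡⟨ +-comm (f (suc b)) _ ⟩
  sumTo (suc b) f                       ∎
  where open ≡-Reasoning

sumTo-extend : ∀ {a b} (f : ℕ → ℕ) → a ≤ b → (∀ {c} → a < c → c ≤ b → f c ≡ 0) →
               sumTo b f ≡ sumTo a f
sumTo-extend {a} f a≤b = go (≤⇒≤′ a≤b)
  where
  go : ∀ {b} → a ≤′ b → (∀ {c} → a < c → c ≤ b → f c ≡ 0) → sumTo b f ≡ sumTo a f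
  go ≤′-refl                  _      = refl
  go (≤′-step {b} a≤′b) tail≗0 = begin
    sumTo b f + f (suc b) ≡⟨ cong₂ _+_ (go a≤′b (λ a<c → tail≗0 a<c ∘ m≤n⇒m≤1+n))
                                       (tail≗0 (s≤s (≤′⇒≤ a≤′b)) ≤-refl) ⟩
    sumTo a f + 0         ≡⟨ +-identityʳ _ ⟩
    sumTo a f             ∎
    where open ≡-Reasoning

sumTo-triangle : ∀ b (g : ℕ → ℕ → ℕ) →
  sumTo b (λ i → sumTo i (λ c → g c (i ∸ c))) ≡ sumTo b (λ c → sumTo (b ∸ c) (g c))
sumTo-triangle zero    g = refl
sumTo-triangle (suc b) g = begin
  sumTo b (λ i → sumTo i (λ c → g c (i ∸ c))) + sumTo (suc b) (λ c → g c (suc b ∸ c))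
    ≡⟨ cong₂ _+_ (sumTo-triangle b g)
                 (cong₂ _+_ (sumTo-cong b (λ {c} c≤b → cong (g c) (+-∸-assoc 1 c≤b)))
                            (cong (g (suc b)) (n∸n≡0 b))) ⟩
  sumTo b rows + (sumTo b diagonal + g (suc b) 0)
    ≡⟨ +-assoc (sumTo b rows) (sumTo b diagonal) (g (suc b) 0) ⟨
  (sumTo b rows + sumTo b diagonal) + g (suc b) 0
    ≡⟨ cong (_+ g (suc b) 0) (sumTo-distrib b rows diagonal) ⟨
  sumTo b (λ c → sumTo (suc (b ∸ c)) (g c)) + g (suc b) 0
    ≡⟨ cong₂ _+_ (sumTo-cong b (λ {c} c≤b → cong (λ t → sumTo t (g c)) (+-∸-assoc 1 c≤b)))
                 (cong (λ t → sumTo t (g (suc b))) (n∸n≡0 b)) ⟨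
  sumTo b (λ c → sumTo (suc b ∸ c) (g c)) + sumTo (b ∸ b) (g (suc b)) ∎
  where
  open ≡-Reasoning
  rows diagonal : ℕ → ℕ
  rows     c = sumTo (b ∸ c) (g c)
  diagonal c = g c (suc (b ∸ c))

-- repsExact (p ∷ ps) j n and partsCount (p ∷ ps) n are, definitionally, sums of
-- atDiff (…) n (c * p) over the multiplicity c of p.
atDiff : (ℕ → ℕ) → ℕ → ℕ → ℕ
atDiff f n x = if ⌊ x ≤? n ⌋ then f (n ∸ x) else 0

module _ (f : ℕ → ℕ) {n x : ℕ} where

  atDiff-yes : x ≤ n → atDiff f n x ≡ f (n ∸ x)
  atDiff-yes x≤n with x ≤? n
  ... | yes _   = refl
  ... | no  x≰n = contradiction x≤n x≰n

  atDiff-no : ¬ x ≤ n → atDiff f n x ≡ 0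
  atDiff-no x≰n with x ≤? n
  ... | yes x≤n = contradiction x≤n x≰n
  ... | no  _   = refl

  atDiff-≡0 : (x ≤ n → f (n ∸ x) ≡ 0) → atDiff f n x ≡ 0
  atDiff-≡0 f≡0 with x ≤? n
  ... | yes x≤n = f≡0 x≤n
  ... | no  _   = refl

  atDiff-cong : ∀ g → (x ≤ n → f (n ∸ x) ≡ g (n ∸ x)) → atDiff f n x ≡ atDiff g n x
  atDiff-cong g f≡g with x ≤? n
  ... | yes x≤n = f≡g x≤n
  ... | no  _   = refl

atDiff-+ : ∀ f {n} c x → c ≤ n → atDiff f n (c + x) ≡ atDiff f (n ∸ c) x
atDiff-+ f {n} c x c≤n with ≤-<-connex x (n ∸ c)
... | inj₁ x≤n∸c = begin
  atDiff f n (c + x)   ≡⟨ atDiff-yes f (subst (_≤ n) (+-comm x c) (m≤o∸n⇒m+n≤o x c≤n x≤n∸c)) ⟩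
  f (n ∸ (c + x))      ≡⟨ cong f (∸-+-assoc n c x) ⟨
  f (n ∸ c ∸ x)        ≡⟨ atDiff-yes f x≤n∸c ⟨
  atDiff f (n ∸ c) x   ∎
  where open ≡-Reasoning
... | inj₂ n∸c<x = begin
  atDiff f n (c + x)   ≡⟨ atDiff-no f (<⇒≱ n∸c<x ∘ m+n≤o⇒m≤o∸n x ∘ subst (_≤ n) (+-comm c x)) ⟩
  0                    ≡⟨ atDiff-no f (<⇒≱ n∸c<x) ⟨
  atDiff f (n ∸ c) x   ∎
  where open ≡-Reasoning

repsExact-vanish : ∀ {d} ps {i n} → All (d ≤_) ps → n < i * d → repsExact ps i n ≡ 0
repsExact-vanish       []       {suc i} _            _    = refl
repsExact-vanish {d} (p ∷ ps) {i} {n} (d≤p ∷ d≤ps) n<id =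
  sumTo-zero i λ {c} c≤i →
    atDiff-≡0 (repsExact ps (i ∸ c)) (repsExact-vanish ps d≤ps ∘ remainder-small c≤i)
  where
  remainder-small : ∀ {c} → c ≤ i → c * p ≤ n → n ∸ c * p < (i ∸ c) * d
  remainder-small {c} c≤i cp≤n = +-cancelˡ-< (c * p) _ _ (begin-strict
    c * p + (n ∸ c * p)  ≡⟨ m+[n∸m]≡n cp≤n ⟩
    n                    <⟨ n<id ⟩
    i * d                ≡⟨ cong (_* d) (m+[n∸m]≡n c≤i) ⟨
    (c + (i ∸ c)) * d    ≡⟨ *-distribʳ-+ d c (i ∸ c) ⟩
    c * d + (i ∸ c) * d  ≤⟨ +-monoˡ-≤ ((i ∸ c) * d) (*-monoʳ-≤ c d≤p) ⟩
    c * p + (i ∸ c) * d  ∎)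
    where open ≤-Reasoning

repsExact-map-suc : ∀ ps j k → repsExact (map suc ps) j (j + k) ≡ repsExact ps j k
repsExact-map-suc []       zero    zero    = refl
repsExact-map-suc []       zero    (suc k) = refl
repsExact-map-suc []       (suc j) k       = refl
repsExact-map-suc (q ∷ ps) j       k       = sumTo-cong j λ {c} c≤j → begin
  atDiff (repsExact (map suc ps) (j ∸ c)) (j + k) (c * suc q)
    ≡⟨ cong (atDiff (repsExact (map suc ps) (j ∸ c)) (j + k)) (*-suc c q) ⟩
  atDiff (repsExact (map suc ps) (j ∸ c)) (j + k) (c + c * q)
    ≡⟨ atDiff-+ (repsExact (map suc ps) (j ∸ c)) c (c * q) (≤-trans c≤j (m≤m+n j k)) ⟩
  atDiff (repsExact (map suc ps) (j ∸ c)) (j + k ∸ c) (c * q)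
    ≡⟨ cong (λ t → atDiff (repsExact (map suc ps) (j ∸ c)) t (c * q)) (+-∸-comm k c≤j) ⟩
  atDiff (repsExact (map suc ps) (j ∸ c)) (j ∸ c + k) (c * q)
    ≡⟨ shifted (j ∸ c) (c * q) ⟩
  atDiff (repsExact ps (j ∸ c)) k (c * q) ∎
  where
  open ≡-Reasoning
  shifted : ∀ r x → atDiff (repsExact (map suc ps) r) (r + k) x ≡ atDiff (repsExact ps r) k x
  shifted r x with ≤-<-connex x k
  ... | inj₁ x≤k = begin
    atDiff (repsExact (map suc ps) r) (r + k) x
      ≡⟨ atDiff-yes (repsExact (map suc ps) r) (≤-trans x≤k (m≤n+m k r)) ⟩
    repsExact (map suc ps) r (r + k ∸ x)
      ≡⟨ cong (repsExact (map suc ps) r) (+-∸-assoc r x≤k) ⟩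
    repsExact (map suc ps) r (r + (k ∸ x))
      ≡⟨ repsExact-map-suc ps r (k ∸ x) ⟩
    repsExact ps r (k ∸ x)
      ≡⟨ atDiff-yes (repsExact ps r) x≤k ⟨
    atDiff (repsExact ps r) k x ∎
  ... | inj₂ k<x = begin
    atDiff (repsExact (map suc ps) r) (r + k) x
      ≡⟨ atDiff-≡0 (repsExact (map suc ps) r)
                   (repsExact-vanish (map suc ps) parts-positive ∘ remainder-small) ⟩
    0
      ≡⟨ atDiff-no (repsExact ps r) (<⇒≱ k<x) ⟨
    atDiff (repsExact ps r) k x ∎
    where
    parts-positive : All (1 ≤_) (map suc ps)
    parts-positive = map⁺ (All.universal (λ _ → s≤s z≤n) ps)
    remainder-small : x ≤ r + k → r + k ∸ x < r * 1
    remainder-small x≤r+k =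
      m<n⇒m<n*o 1 (subst (r + k ∸ x <_) (m+n∸n≡m r x) (∸-monoˡ-< (+-monoʳ-< r k<x) x≤r+k))

repsExact-0∷ : ∀ ps j n → repsExact (0 ∷ ps) j n ≡ sumTo j (λ i → repsExact ps i n)
repsExact-0∷ ps j n = begin
  repsExact (0 ∷ ps) j n
    ≡⟨ sumTo-cong j (λ {c} _ → cong (atDiff (repsExact ps (j ∸ c)) n) (*-zeroʳ c)) ⟩
  sumTo j (λ c → repsExact ps (j ∸ c) n)
    ≡⟨ sumTo-reverse j (λ i → repsExact ps i n) ⟩
  sumTo j (λ i → repsExact ps i n) ∎
  where open ≡-Reasoning

partsCount≡sumTo-repsExact : ∀ ps {n b} → All (0 <_) ps → n ≤ b →
                             partsCount ps n ≡ sumTo b (λ i → repsExact ps i n)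
partsCount≡sumTo-repsExact [] {zero}  {b} _ _ =
  sym (sumTo-extend (λ i → repsExact [] i 0) (z≤n {b}) λ { {suc _} _ _ → refl })
partsCount≡sumTo-repsExact [] {suc n} {b} _ _ =
  sym (sumTo-extend (λ i → repsExact [] i (suc n)) (z≤n {b}) λ { {suc _} _ _ → refl })
partsCount≡sumTo-repsExact (p ∷ ps) {n} {b} (0<p ∷ 0<ps) n≤b = sym (begin
  sumTo b (λ i → repsExact (p ∷ ps) i n)
    ≡⟨ sumTo-triangle b (λ c i → atDiff (repsExact ps i) n (c * p)) ⟩
  sumTo b (λ c → sumTo (b ∸ c) (λ i → atDiff (repsExact ps i) n (c * p)))
    ≡⟨ sumTo-cong b column ⟩
  sumTo b (λ c → atDiff (partsCount ps) n (c * p))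
    ≡⟨ sumTo-extend (λ c → atDiff (partsCount ps) n (c * p)) n≤b (λ {c} n<c _ →
         atDiff-no (partsCount ps) (<⇒≱ (<-≤-trans n<c (c≤c*p c)))) ⟩
  partsCount (p ∷ ps) n ∎)
  where
  open ≡-Reasoning
  c≤c*p : ∀ c → c ≤ c * p
  c≤c*p c = m≤m*n c p {{>-nonZero 0<p}}
  column : ∀ {c} → c ≤ b → sumTo (b ∸ c) (λ i → atDiff (repsExact ps i) n (c * p))
                           ≡ atDiff (partsCount ps) n (c * p)
  column {c} c≤b with ≤-<-connex (c * p) n
  ... | inj₁ cp≤n = begin
    sumTo (b ∸ c) (λ i → atDiff (repsExact ps i) n (c * p))
      ≡⟨ sumTo-cong (b ∸ c) (λ {i} _ → atDiff-yes (repsExact ps i) cp≤n) ⟩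
    sumTo (b ∸ c) (λ i → repsExact ps i (n ∸ c * p))
      ≡⟨ partsCount≡sumTo-repsExact ps 0<ps (∸-mono n≤b (c≤c*p c)) ⟨
    partsCount ps (n ∸ c * p)
      ≡⟨ atDiff-yes (partsCount ps) cp≤n ⟨
    atDiff (partsCount ps) n (c * p) ∎
  ... | inj₂ n<cp = begin
    sumTo (b ∸ c) (λ i → atDiff (repsExact ps i) n (c * p))
      ≡⟨ sumTo-zero (b ∸ c) (λ {i} _ → atDiff-no (repsExact ps i) (<⇒≱ n<cp)) ⟩
    0
      ≡⟨ atDiff-no (partsCount ps) (<⇒≱ n<cp) ⟨
    atDiff (partsCount ps) n (c * p) ∎

repsExact-0∷≡partsCount : ∀ {d} ps {j n} → 0 < d → All (d ≤_) ps → n ≤ j * d →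
                          repsExact (0 ∷ ps) j n ≡ partsCount ps n
repsExact-0∷≡partsCount {d} ps {j} {n} 0<d d≤ps n≤jd = begin
  repsExact (0 ∷ ps) j n
    ≡⟨ repsExact-0∷ ps j n ⟩
  sumTo j (λ i → repsExact ps i n)
    ≡⟨ sumTo-extend (λ i → repsExact ps i n) (m≤m+n j n) too-many ⟨
  sumTo (j + n) (λ i → repsExact ps i n)
    ≡⟨ partsCount≡sumTo-repsExact ps 0<ps (m≤n+m n j) ⟨
  partsCount ps n ∎
  where
  open ≡-Reasoning
  0<ps : All (0 <_) ps
  0<ps = All.map (<-≤-trans 0<d) d≤ps
  too-many : ∀ {i} → j < i → i ≤ j + n → repsExact ps i n ≡ 0
  too-many j<i _ = repsExact-vanish ps d≤ps (≤-<-trans n≤jd (*-monoˡ-< d {{>-nonZero 0<d}} j<i))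

partsCount-beyond : ∀ {n} rs → All (n <_) rs → partsCount rs n ≡ partsCount [] n
partsCount-beyond       []       _            = refl
partsCount-beyond {n} (r ∷ rs) (n<r ∷ n<rs) = trans
  (sumTo-extend (λ c → atDiff (partsCount rs) n (c * r)) (z≤n {n}) λ {c} 0<c _ →
     atDiff-no (partsCount rs) (<⇒≱ (<-≤-trans n<r (m≤n*m r c {{>-nonZero 0<c}}))))
  (partsCount-beyond rs n<rs)

partsCount-++-beyond : ∀ ps {rs n} → All (n <_) rs → partsCount (ps ++ rs) n ≡ partsCount ps n
partsCount-++-beyond []       {rs}     n<rs = partsCount-beyond rs n<rs
partsCount-++-beyond (p ∷ ps) {rs} {n} n<rs = sumTo-cong n λ {c} _ →
  atDiff-cong (partsCount (ps ++ rs)) (partsCount ps) λ _ →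
    partsCount-++-beyond ps (All.map (≤-<-trans (m∸n≤m n (c * p))) n<rs)

applyUpTo-cong : ∀ {A : Set} {f g : ℕ → A} → (∀ i → f i ≡ g i) → ∀ n → applyUpTo f n ≡ applyUpTo g n
applyUpTo-cong f≗g zero    = refl
applyUpTo-cong f≗g (suc n) = cong₂ _∷_ (f≗g 0) (applyUpTo-cong (f≗g ∘ suc) n)

applyUpTo-++ : ∀ {A : Set} (f : ℕ → A) a b →
               applyUpTo f (a + b) ≡ applyUpTo f a ++ applyUpTo (f ∘ (a +_)) b
applyUpTo-++ f zero    b = refl
applyUpTo-++ f (suc a) b = cong (f 0 ∷_) (applyUpTo-++ (f ∘ suc) a b)

i<prodM : ∀ {m} → 0 < m 0 → (∀ i → 2 ≤ m (suc i)) → ∀ i → i < prodM m i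
i<prodM 0<m₀ _   zero    = 0<m₀
i<prodM {m} 0<m₀ 2≤m (suc i) = begin-strict
  suc i                 <⟨ s≤s (s≤s (m≤m*n i 2)) ⟩
  suc i * 2             ≤⟨ *-mono-≤ (i<prodM 0<m₀ 2≤m i) (2≤m i) ⟩
  prodM m i * m (suc i) ∎
  where open ≤-Reasoning

prodM-mono-≤ : ∀ {m} → (∀ i → 0 < m (suc i)) → ∀ {i j} → i ≤ j → prodM m i ≤ prodM m j
prodM-mono-≤ {m} 0<m i≤j = go (≤⇒≤′ i≤j)
  where
  go : ∀ {i j} → i ≤′ j → prodM m i ≤ prodM m j
  go ≤′-refl            = ≤-refl
  go (≤′-step {j} i≤′j) = ≤-trans (go i≤′j) (m≤m*n (prodM m j) (m (suc j)) {{>-nonZero (0<m j)}})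

module _ {m n o : ℕ} where

  m*n≤o*[n∸1]⇒m≤o : 1 < n → m * n ≤ o * (n ∸ 1) → m ≤ o
  m*n≤o*[n∸1]⇒m≤o (s≤s (s≤s {n = d} _)) mn≤od = *-cancelʳ-≤ m o (suc d) (begin
    m * suc d           ≤⟨ m≤n+m (m * suc d) m ⟩
    m + m * suc d       ≡⟨ *-suc m (suc d) ⟨
    m * n               ≤⟨ mn≤od ⟩
    o * suc d           ∎)
    where open ≤-Reasoning

  m*n≤o*[n∸1]⇒m≤[o∸m]*[n∸1] : 1 < n → m * n ≤ o * (n ∸ 1) → m ≤ (o ∸ m) * (n ∸ 1)
  m*n≤o*[n∸1]⇒m≤[o∸m]*[n∸1] 1<n@(s≤s (s≤s {n = d} _)) mn≤od =
    +-cancelʳ-≤ (m * suc d) m ((o ∸ m) * suc d) (begin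
      m + m * suc d                ≡⟨ *-suc m (suc d) ⟨
      m * n                        ≤⟨ mn≤od ⟩
      o * suc d                    ≡⟨ cong (_* suc d) (m∸n+n≡m (m*n≤o*[n∸1]⇒m≤o 1<n mn≤od)) ⟨
      (o ∸ m + m) * suc d          ≡⟨ *-distribʳ-+ (suc d) (o ∸ m) m ⟩
      (o ∸ m) * suc d + m * suc d  ∎)
    where open ≤-Reasoning

module _ {m : ℕ → ℕ} (m₀≡1 : m 0 ≡ 1) (2≤m : ∀ i → 2 ≤ m (suc i)) where

  private
    M q : ℕ → ℕ
    M = prodM m
    q i = M (suc i) ∸ 1

    i<M : ∀ i → i < M i
    i<M = i<prodM (subst (0 <_) (sym m₀≡1) z<s) 2≤m

    m₁≤M : ∀ i → m 1 ≤ M (suc i)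
    m₁≤M i = subst (_≤ M (suc i)) (trans (cong (_* m 1) m₀≡1) (*-identityˡ (m 1)))
                   (prodM-mono-≤ {m} (λ j → <-trans z<s (2≤m j)) {1} {suc i} (s≤s z≤n))

    M∘suc≡suc∘q : ∀ t → applyUpTo (M ∘ suc) t ≡ map suc (applyUpTo q t)
    M∘suc≡suc∘q t = trans (applyUpTo-cong (λ i → sym (m+[n∸m]≡n (<-trans z<s (i<M (suc i))))) t)
                          (sym (map-applyUpTo q suc t))

  aM≡sM : ∀ j k → k ≤ j * (m 1 ∸ 1) → aM m j (j + k) ≡ sM m k
  aM≡sM j k k≤jd = begin
    aM m j (j + k)
      ≡⟨ cong (λ ps → repsExact ps j (j + k)) (cong₂ _∷_ m₀≡1 (M∘suc≡suc∘q (j + k))) ⟩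
    repsExact (map suc (0 ∷ applyUpTo q (j + k))) j (j + k)
      ≡⟨ repsExact-map-suc (0 ∷ applyUpTo q (j + k)) j k ⟩
    repsExact (0 ∷ applyUpTo q (j + k)) j k
      ≡⟨ repsExact-0∷≡partsCount (applyUpTo q (j + k)) {j} (∸-monoˡ-≤ 1 (2≤m 0))
           (applyUpTo⁺₂ q (j + k) (∸-monoˡ-≤ 1 ∘ m₁≤M)) k≤jd ⟩
    partsCount (applyUpTo q (j + k)) k
      ≡⟨ cong (λ ps → partsCount ps k)
              (trans (cong (applyUpTo q) (+-comm j k)) (applyUpTo-++ q k j)) ⟩
    partsCount (applyUpTo q k ++ applyUpTo (q ∘ (k +_)) j) k
      ≡⟨ partsCount-++-beyond (applyUpTo q k) (applyUpTo⁺₂ (q ∘ (k +_)) j k<q) ⟩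
    sM m k ∎
    where
    open ≡-Reasoning
    k<q : ∀ i → k < q (k + i)
    k<q i = ≤-trans (s≤s (m≤m+n k i)) (∸-monoˡ-≤ 1 (i<M (suc (k + i))))

corollary6p9 : (m : ℕ → ℕ) → m 0 ≡ 1 → (∀ i → 2 ≤ m (suc i)) →
    (k n : ℕ) → k * m 1 ≤ n * (m 1 ∸ 1) →
    aM m (n ∸ k) n ≡ sM m k
corollary6p9 m m₀≡1 2≤m k n hyp = begin
  aM m (n ∸ k) n            ≡⟨ cong (aM m (n ∸ k)) (m∸n+n≡m {n} {k} (m*n≤o*[n∸1]⇒m≤o (2≤m 0) hyp)) ⟨
  aM m (n ∸ k) (n ∸ k + k)  ≡⟨ aM≡sM m₀≡1 2≤m (n ∸ k) k (m*n≤o*[n∸1]⇒m≤[o∸m]*[n∸1] (2≤m 0) hyp) ⟩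
  sM m k                    ∎
  where open ≡-Reasoning
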